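{- Let $F$ be a fragment in the square grid and let $s$ be a cell with $s \notin F$ such that $s$ is a neighbor of some cell of $F$. Then $F \cup \{s\}$ is either a single fragment or the union of two disjoint fragments.
   Context: In the square grid (cells are unit squares with integer corners; two cells are neighbors if they share an edge), a fragment is a set of cells consisting of a cell $c$ together with a nonempty subset of the four neighbors of $c$; equivalently, a connected subset with at least two cells of an X-pentomino (a cell together with its four neighbors). -}

module Defs where

open import Data.Integer using (ℤ; _+_; _-_; +_)
open import Data.Product using (Σ; _×_; _,_)
open import Data.Sum using (_⊎_)
open import Data.Bool using (Bool; true)
open import Relation.Binary.PropositionalEquality using (_≡_)

-- A cell of the square grid, identified by the integer coordinates of its
-- lower-left corner.
Cell : Set
Cell = ℤ × ℤ

data Dir : Set where
  north east south west : Dir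

move : Dir → Cell → Cell
move north (x , y) = (x , y + + 1)
move south (x , y) = (x , y - + 1)
move east  (x , y) = (x + + 1 , y)
move west  (x , y) = (x - + 1 , y)

Neighbor : Cell → Cell → Set
Neighbor a b = Σ Dir λ d → b ≡ move d a

-- A fragment: a cell c together with a nonempty subset of its four neighbors
-- (the subset is given by its characteristic function on directions).
record Fragment : Set where
  field
    center   : Cell
    arms     : Dir → Bool
    nonempty : Σ Dir λ d → arms d ≡ true

open Fragment public

_∈F_ : Cell → Fragment → Set
x ∈F F = (x ≡ center F) ⊎ (Σ Dir λ d → (arms F d ≡ true) × (x ≡ move d (center F)))

-- Let c be the centre of F and let s be adjacent to the cell c' of F.  If
-- c' = c, then s is just a new arm at c.  Otherwise c' = c + e for an arm e.
-- If e is the only arm, F ∪ {s} is the fragment centred at c' with arms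
-- towards c and s.  If some other arm f remains, F ∪ {s} splits into F
-- without the arm e, still a fragment thanks to f, and the domino {c', s},
-- which are disjoint because s ∉ F.
module Submission where

open import Defs
open import Algebra.Bundles using (AbelianGroup)
open import Data.Bool using (Bool; true; not; _∧_; _∨_)
import Data.Bool as Bool
open import Data.Bool.Properties using (∨-zeroʳ)
open import Data.Empty using (⊥-elim)
open import Data.Integer using (ℤ; _+_; +_; -[1+_])
import Data.Integer.Properties as ℤ
open import Data.Product using (Σ; _×_; _,_)
open import Data.Product.Properties using (,-injectiveˡ; ,-injectiveʳ; ≡-dec)
open import Data.Sum using (_⊎_; inj₁; inj₂; swap; map₁; map₂)
open import Data.Sum.Function.Propositional using (_⊎-⇔_)
open import Function using (_∘_; case_of_)
open import Function.Bundles using (_⇔_; mk⇔; Equivalence)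
import Function.Properties.Equivalence as ⇔
open import Relation.Binary.Definitions using (DecidableEquality)
open import Relation.Binary.PropositionalEquality
  using (_≡_; _≢_; refl; sym; trans; cong; cong₂; module ≡-Reasoning)
open import Relation.Nullary using (¬_; Dec; yes; no; does; ¬?; _×-dec_; map′)
open import Relation.Nullary.Decidable using (dec-true; dec-false; decidable-stable)

open import Algebra.Properties.Group (AbelianGroup.group ℤ.+-0-abelianGroup)
  using (∙-cancelˡ)

offset : Dir → ℤ × ℤ
offset north = + 0 , + 1
offset east  = + 1 , + 0
offset south = + 0 , -[1+ 0 ]
offset west  = -[1+ 0 ] , + 0

offset-injective : ∀ {d e} → offset d ≡ offset e → d ≡ e
offset-injective {north} {north} _ = refl
offset-injective {north} {east}  ()
offset-injective {north} {south} ()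
offset-injective {north} {west}  ()
offset-injective {east}  {north} ()
offset-injective {east}  {east}  _ = refl
offset-injective {east}  {south} ()
offset-injective {east}  {west}  ()
offset-injective {south} {north} ()
offset-injective {south} {east}  ()
offset-injective {south} {south} _ = refl
offset-injective {south} {west}  ()
offset-injective {west}  {north} ()
offset-injective {west}  {east}  ()
offset-injective {west}  {south} ()
offset-injective {west}  {west}  _ = refl

offset-nonzero : ∀ d → offset d ≢ (+ 0 , + 0)
offset-nonzero north ()
offset-nonzero east  ()
offset-nonzero south ()
offset-nonzero west  ()

-- Opaque so that `with d ≟ g` abstracts the occurrences of `does (d ≟ g)` in arms.
opaque
  _≟_ : DecidableEquality Dir
  d ≟ e = map′ offset-injective (cong offset) (≡-dec ℤ._≟_ ℤ._≟_ (offset d) (offset e))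

_⊕_ : ℤ × ℤ → ℤ × ℤ → ℤ × ℤ
(x , y) ⊕ (u , v) = x + u , y + v

⊕-assoc : ∀ p q r → (p ⊕ q) ⊕ r ≡ p ⊕ (q ⊕ r)
⊕-assoc (x , y) (u , v) (w , z) = cong₂ _,_ (ℤ.+-assoc x u w) (ℤ.+-assoc y v z)

⊕-identityʳ : ∀ p → p ⊕ (+ 0 , + 0) ≡ p
⊕-identityʳ (x , y) = cong₂ _,_ (ℤ.+-identityʳ x) (ℤ.+-identityʳ y)

⊕-cancelˡ : ∀ p {q r} → p ⊕ q ≡ p ⊕ r → q ≡ r
⊕-cancelˡ (x , y) {u , v} {w , z} eq =
  cong₂ _,_ (∙-cancelˡ x u w (,-injectiveˡ eq)) (∙-cancelˡ y v z (,-injectiveʳ eq))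

opposite : Dir → Dir
opposite north = south
opposite east  = west
opposite south = north
opposite west  = east

offset-opposite : ∀ d → offset d ⊕ offset (opposite d) ≡ (+ 0 , + 0)
offset-opposite north = refl
offset-opposite east  = refl
offset-opposite south = refl
offset-opposite west  = refl

move≡⊕offset : ∀ d c → move d c ≡ c ⊕ offset d
move≡⊕offset north (x , y) = cong (_, y + + 1) (sym (ℤ.+-identityʳ x))
move≡⊕offset east  (x , y) = cong (x + + 1 ,_) (sym (ℤ.+-identityʳ y))
move≡⊕offset south (x , y) = cong (_, y + -[1+ 0 ]) (sym (ℤ.+-identityʳ x))
move≡⊕offset west  (x , y) = cong (x + -[1+ 0 ] ,_) (sym (ℤ.+-identityʳ y))

move-injective : ∀ {d e} c → move d c ≡ move e c → d ≡ e
move-injective {d} {e} c eq = offset-injective (⊕-cancelˡ c (begin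
  c ⊕ offset d  ≡⟨ move≡⊕offset d c ⟨
  move d c      ≡⟨ eq ⟩
  move e c      ≡⟨ move≡⊕offset e c ⟩
  c ⊕ offset e  ∎))
  where open ≡-Reasoning

move-≢ : ∀ d c → move d c ≢ c
move-≢ d c eq = offset-nonzero d (⊕-cancelˡ c (begin
  c ⊕ offset d    ≡⟨ move≡⊕offset d c ⟨
  move d c        ≡⟨ eq ⟩
  c               ≡⟨ ⊕-identityʳ c ⟨
  c ⊕ (+ 0 , + 0) ∎))
  where open ≡-Reasoning

move-opposite : ∀ d c → move (opposite d) (move d c) ≡ c
move-opposite d c = begin
  move (opposite d) (move d c)               ≡⟨ move≡⊕offset (opposite d) (move d c) ⟩
  move d c ⊕ offset (opposite d)             ≡⟨ cong (_⊕ offset (opposite d)) (move≡⊕offset d c) ⟩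
  (c ⊕ offset d) ⊕ offset (opposite d)       ≡⟨ ⊕-assoc c (offset d) (offset (opposite d)) ⟩
  c ⊕ (offset d ⊕ offset (opposite d))       ≡⟨ cong (c ⊕_) (offset-opposite d) ⟩
  c ⊕ (+ 0 , + 0)                            ≡⟨ ⊕-identityʳ c ⟩
  c                                          ∎
  where open ≡-Reasoning

searchDir : (P : Dir → Set) → (∀ d → Dec (P d)) → (Σ Dir P) ⊎ (∀ d → ¬ P d)
searchDir P P? with P? north | P? east | P? south | P? west
... | yes p | _     | _     | _     = inj₁ (north , p)
... | no _  | yes p | _     | _     = inj₁ (east , p)
... | no _  | no _  | yes p | _     = inj₁ (south , p)
... | no _  | no _  | no _  | yes p = inj₁ (west , p)
... | no ¬n | no ¬e | no ¬s | no ¬w = inj₂ λ { north → ¬n ; east → ¬e ; south → ¬s ; west → ¬w }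

anotherArm : (a : Dir → Bool) (e : Dir) →
  (Σ Dir λ f → f ≢ e × a f ≡ true) ⊎ (∀ f → a f ≡ true → f ≡ e)
anotherArm a e with searchDir (λ f → f ≢ e × a f ≡ true) (λ f → ¬? (f ≟ e) ×-dec (a f Bool.≟ true))
... | inj₁ found = inj₁ found
... | inj₂ none  = inj₂ λ f af → decidable-stable (f ≟ e) (λ f≢e → none f (f≢e , af))

domino : Cell → Dir → Fragment
domino c d = record { center = c ; arms = does ∘ (d ≟_) ; nonempty = d , dec-true (d ≟ d) refl }

addArm : Fragment → Dir → Fragment
addArm F d = record
  { center   = center F
  ; arms     = λ g → does (d ≟ g) ∨ arms F g
  ; nonempty = d , cong (_∨ arms F d) (dec-true (d ≟ d) refl)
  }

removeArm : (F : Fragment) (e f : Dir) → f ≢ e → arms F f ≡ true → Fragment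
removeArm F e f f≢e af = record
  { center   = center F
  ; arms     = λ g → not (does (e ≟ g)) ∧ arms F g
  ; nonempty = f , trans (cong (λ b → not b ∧ arms F f) (dec-false (e ≟ f) (f≢e ∘ sym))) af
  }

∈-domino : ∀ c d x → x ∈F domino c d ⇔ ((x ≡ c) ⊎ (x ≡ move d c))
∈-domino c d x = mk⇔ to from
  where
  to : x ∈F domino c d → (x ≡ c) ⊎ (x ≡ move d c)
  to (inj₁ x≡c) = inj₁ x≡c
  to (inj₂ (g , t , x≡)) with d ≟ g
  to (inj₂ (g , t , x≡))  | yes refl = inj₂ x≡
  to (inj₂ (g , () , x≡)) | no _
  from : (x ≡ c) ⊎ (x ≡ move d c) → x ∈F domino c d
  from (inj₁ x≡c) = inj₁ x≡c
  from (inj₂ x≡)  = inj₂ (d , dec-true (d ≟ d) refl , x≡)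

∈-addArm : ∀ F d x → x ∈F addArm F d ⇔ ((x ∈F F) ⊎ (x ≡ move d (center F)))
∈-addArm F d x = mk⇔ to from
  where
  to : x ∈F addArm F d → (x ∈F F) ⊎ (x ≡ move d (center F))
  to (inj₁ x≡c) = inj₁ (inj₁ x≡c)
  to (inj₂ (g , t , x≡)) with d ≟ g
  ... | yes refl = inj₂ x≡
  ... | no _     = inj₁ (inj₂ (g , t , x≡))
  from : (x ∈F F) ⊎ (x ≡ move d (center F)) → x ∈F addArm F d
  from (inj₁ (inj₁ x≡c))           = inj₁ x≡c
  from (inj₁ (inj₂ (g , ag , x≡))) = inj₂ (g , trans (cong (does (d ≟ g) ∨_) ag) (∨-zeroʳ _) , x≡)
  from (inj₂ x≡)                   = inj₂ (d , cong (_∨ arms F d) (dec-true (d ≟ d) refl) , x≡)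

∈-removeArm : ∀ F e f f≢e af x →
  x ∈F removeArm F e f f≢e af ⇔ ((x ∈F F) × x ≢ move e (center F))
∈-removeArm F e f f≢e af x = mk⇔ to from
  where
  c : Cell
  c = center F
  to : x ∈F removeArm F e f f≢e af → (x ∈F F) × x ≢ move e c
  to (inj₁ x≡c) = inj₁ x≡c , λ x≡ → move-≢ e c (trans (sym x≡) x≡c)
  to (inj₂ (g , t , x≡)) with e ≟ g
  to (inj₂ (g , () , x≡)) | yes refl
  to (inj₂ (g , t , x≡))  | no e≢g =
    inj₂ (g , t , x≡) , λ x≡′ → e≢g (move-injective c (trans (sym x≡′) x≡))
  from : (x ∈F F) × x ≢ move e c → x ∈F removeArm F e f f≢e af
  from (inj₁ x≡c , _) = inj₁ x≡c
  from (inj₂ (g , ag , x≡) , x≢) with e ≟ g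
  ... | yes refl = ⊥-elim (x≢ x≡)
  ... | no e≢g   = inj₂ (g , trans (cong (λ b → not b ∧ arms F g) (dec-false (e ≟ g) e≢g)) ag , x≡)

∈-singleArm : ∀ F e → arms F e ≡ true → (∀ f → arms F f ≡ true → f ≡ e) →
  ∀ x → x ∈F F ⇔ x ∈F domino (center F) e
∈-singleArm F e ae onlyE x = ⇔.trans (mk⇔ to from) (⇔.sym (∈-domino (center F) e x))
  where
  c : Cell
  c = center F
  to : x ∈F F → (x ≡ c) ⊎ (x ≡ move e c)
  to (inj₁ x≡c)           = inj₁ x≡c
  to (inj₂ (g , ag , x≡)) = inj₂ (trans x≡ (cong (λ h → move h c) (onlyE g ag)))
  from : (x ≡ c) ⊎ (x ≡ move e c) → x ∈F F
  from (inj₁ x≡c) = inj₁ x≡c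
  from (inj₂ x≡)  = inj₂ (e , ae , x≡)

∈-domino-reverse : ∀ c e x → x ∈F domino c e ⇔ x ∈F domino (move e c) (opposite e)
∈-domino-reverse c e x =
  ⇔.trans (∈-domino c e x) (⇔.trans (mk⇔ to from) (⇔.sym (∈-domino (move e c) (opposite e) x)))
  where
  back : move (opposite e) (move e c) ≡ c
  back = move-opposite e c
  to : (x ≡ c) ⊎ (x ≡ move e c) → (x ≡ move e c) ⊎ (x ≡ move (opposite e) (move e c))
  to = swap ∘ map₁ (λ x≡c → trans x≡c (sym back))
  from : (x ≡ move e c) ⊎ (x ≡ move (opposite e) (move e c)) → (x ≡ c) ⊎ (x ≡ move e c)
  from = swap ∘ map₂ (λ x≡ → trans x≡ back)

⊎-splitOff : {P M S : Set} → Dec M → (M → P) → (P ⊎ S) ⇔ ((P × ¬ M) ⊎ (M ⊎ S))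
⊎-splitOff {P} {M} {S} M? M⇒P = mk⇔ to from
  where
  to : P ⊎ S → (P × ¬ M) ⊎ (M ⊎ S)
  to (inj₁ p) = case M? of λ where
    (yes m) → inj₂ (inj₁ m)
    (no ¬m) → inj₁ (p , ¬m)
  to (inj₂ s) = inj₂ (inj₂ s)
  from : (P × ¬ M) ⊎ (M ⊎ S) → P ⊎ S
  from (inj₁ (p , _))  = inj₁ p
  from (inj₂ (inj₁ m)) = inj₁ (M⇒P m)
  from (inj₂ (inj₂ s)) = inj₂ s

mainTheorem4 : (F : Fragment) (s : Cell) → ¬ (s ∈F F) →
    (Σ Cell λ c → (c ∈F F) × Neighbor c s) →
    (Σ Fragment λ G → ∀ x → ((x ∈F F) ⊎ (x ≡ s)) ⇔ (x ∈F G))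
    ⊎ (Σ Fragment λ G₁ → Σ Fragment λ G₂ →
         (∀ x → ¬ ((x ∈F G₁) × (x ∈F G₂)))
         × (∀ x → ((x ∈F F) ⊎ (x ≡ s)) ⇔ ((x ∈F G₁) ⊎ (x ∈F G₂))))
mainTheorem4 F _ _ (_ , inj₁ refl , d , refl) =
  inj₁ (addArm F d , λ x → ⇔.sym (∈-addArm F d x))
mainTheorem4 F _ s∉F (_ , inj₂ (e , ae , refl) , d , refl) with anotherArm (arms F) e
... | inj₁ (f , f≢e , af) = inj₂ (F∖m , domino m d , disjoint , λ x →
      ⇔.trans (⊎-splitOff (≡-dec ℤ._≟_ ℤ._≟_ x m) (λ { refl → m∈F }))
              (⇔.sym (∈-removeArm F e f f≢e af x ⊎-⇔ ∈-domino m d x)))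
  where
  m : Cell
  m = move e (center F)
  m∈F : m ∈F F
  m∈F = inj₂ (e , ae , refl)
  F∖m : Fragment
  F∖m = removeArm F e f f≢e af
  disjoint : ∀ x → ¬ ((x ∈F F∖m) × (x ∈F domino m d))
  disjoint x (x∈F∖m , x∈md)
    with Equivalence.to (∈-removeArm F e f f≢e af x) x∈F∖m | Equivalence.to (∈-domino m d x) x∈md
  ... | _ , x≢m | inj₁ x≡m = x≢m x≡m
  ... | x∈F , _ | inj₂ refl = s∉F x∈F
... | inj₂ onlyE = inj₁ (addArm (domino m (opposite e)) d , λ x →
      ⇔.trans (⇔.trans (∈-singleArm F e ae onlyE x) (∈-domino-reverse (center F) e x) ⊎-⇔ ⇔.refl)
              (⇔.sym (∈-addArm (domino m (opposite e)) d x)))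
  where
  m : Cell
  m = move e (center F)
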